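{- Let $u$ be a vertex of odd degree in a finite simple graph $G$, let $B\subseteq E_G(u)$, and let $\mathcal{D}_0$ be a path decomposition of $G\setminus B$. Let $A_1\subseteq B$ be a set addible towards $u$ with respect to $\mathcal{D}_0$, and let $\mathcal{D}_1$ be an $A_1$-transformation of $\mathcal{D}_0$ (a decomposition of $(G\setminus B)+A_1$). Let $A_2\subseteq B\setminus A_1$ be a set addible outwards $u$ with respect to $\mathcal{D}_1$, and let $\mathcal{D}_2$ be an $A_2$-transformation of $\mathcal{D}_1$. If $|A_1|\ge\lceil |B|/2\rceil$, then $\mathcal{D}_2(u)>|B|-|A_1\cup A_2|$.
   Context: A path decomposition of a graph $H$ is a collection of edge-disjoint paths of $H$ covering $E(H)$; for a path decomposition $\mathcal{D}$ and vertex $v$, $\mathcal{D}(v)$ is the number of paths of $\mathcal{D}$ having $v$ as an end vertex. $E_G(u)$ is the set of edges of $G$ incident to $u$, and $G\setminus B=(V(G),E(G)\setminus B)$. Addibility: let $H$ be a graph, $u$ a vertex, $\mathcal{D}'$ a path decomposition of $H$, and $A=\{ux_1,\dots,ux_k\}$ a set of edges incident to $u$ not in $H$ (with $H+A$ a subgraph of $G$). $A$ is addible towards $u$ (resp. outwards $u$) with respect to $\mathcal{D}'$ if $H+A$ has a path decomposition $\mathcal{D}$ with $|\mathcal{D}|=|\mathcal{D}'|$, $\mathcal{D}(u)=\mathcal{D}'(u)+|A|$ and $\mathcal{D}(x_i)=\mathcal{D}'(x_i)-1$ for all $i$ (resp. $\mathcal{D}(u)=\mathcal{D}'(u)-|A|$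 and $\mathcal{D}(x_i)=\mathcal{D}'(x_i)+1$ for all $i$), and $\mathcal{D}(v)=\mathcal{D}'(v)$ for all other vertices $v$. Such a $\mathcal{D}$ is called an $A$-transformation of $\mathcal{D}'$ towards (resp. outwards) $u$. Here $A_1$ is added to $H=G\setminus B$, and $A_2$ is added to $H=(G\setminus B)+A_1$. -}

module Defs where

open import Data.Nat using (ℕ; zero; suc; _+_; _≤_; _%_)
open import Data.Bool using (Bool; true; false; _∧_; _∨_; not; if_then_else_)
open import Data.Fin using (Fin; _≟_)
open import Data.Fin.Subset using (Subset; _∈_; ∣_∣)
open import Data.Vec using (lookup)
open import Data.List using (List; []; _∷_; length; filter; map)
open import Data.Nat.ListAction using (sum)
open import Data.List.Relation.Unary.All using (All)
open import Data.List.Relation.Unary.Unique.Propositional using (Unique)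
open import Data.Product using (_×_; _,_; Σ)
open import Relation.Nullary.Decidable using (⌊_⌋)
open import Relation.Binary.PropositionalEquality using (_≡_)

EdgeRel : ℕ → Set
EdgeRel n = Fin n → Fin n → Bool

record SimpleGraph (n : ℕ) : Set where
  field
    adj    : EdgeRel n
    sym    : ∀ i j → adj i j ≡ adj j i
    irrefl : ∀ i → adj i i ≡ false
open SimpleGraph public

deg : ∀ {n} → SimpleGraph n → Fin n → ℕ
deg {n} G u = length (filter (λ j → adj G u j Data.Bool.≟ true) (Data.List.allFin n))
  where import Data.Bool
        import Data.List

-- A set of edges incident to u is encoded by the subset X of their other
-- endpoints: X represents the edge set { u x | x ∈ X }.
-- star u X i j  holds iff  ij is one of the edges u x, x ∈ X.
star : ∀ {n} → Fin n → Subset n → EdgeRel n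
star u X i j = (⌊ i ≟ u ⌋ ∧ lookup X j) ∨ (⌊ j ≟ u ⌋ ∧ lookup X i)

StarIn : ∀ {n} → SimpleGraph n → Fin n → Subset n → Set
StarIn G u X = ∀ x → x ∈ X → adj G u x ≡ true

removeStar : ∀ {n} → EdgeRel n → Fin n → Subset n → EdgeRel n
removeStar H u X i j = H i j ∧ not (star u X i j)

addStar : ∀ {n} → EdgeRel n → Fin n → Subset n → EdgeRel n
addStar H u X i j = H i j ∨ star u X i j

lastOf : ∀ {n} → Fin n → List (Fin n) → Fin n
lastOf x []       = x
lastOf x (y ∷ ys) = lastOf y ys

pairsFrom : ∀ {n} → Fin n → List (Fin n) → List (Fin n × Fin n)
pairsFrom x []       = []
pairsFrom x (y ∷ ys) = (x , y) ∷ pairsFrom y ys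

pairs : ∀ {n} → List (Fin n) → List (Fin n × Fin n)
pairs []       = []
pairs (x ∷ xs) = pairsFrom x xs

IsPath : ∀ {n} → EdgeRel n → List (Fin n) → Set
IsPath H p = (2 ≤ length p) × Unique p × All (λ e → H (Data.Product.proj₁ e) (Data.Product.proj₂ e) ≡ true) (pairs p)
  where import Data.Product

occ : ∀ {n} → Fin n → Fin n → List (Fin n) → ℕ
occ i j p = length (filter (λ e → sameEdge e Data.Bool.≟ true) (pairs p))
  where
  import Data.Bool
  sameEdge : _ → Bool
  sameEdge (a , b) = (⌊ a ≟ i ⌋ ∧ ⌊ b ≟ j ⌋) ∨ (⌊ a ≟ j ⌋ ∧ ⌊ b ≟ i ⌋)

-- Path decomposition of H: a collection of paths of H, edge-disjoint and
-- covering E(H): every edge of H is traversed exactly once in total.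
IsPathDecomposition : ∀ {n} → EdgeRel n → List (List (Fin n)) → Set
IsPathDecomposition H D =
  All (IsPath H) D × (∀ i j → H i j ≡ true → sum (map (occ i j) D) ≡ 1)

isEnd : ∀ {n} → Fin n → List (Fin n) → Bool
isEnd v []       = false
isEnd v (x ∷ xs) = ⌊ x ≟ v ⌋ ∨ ⌊ lastOf x xs ≟ v ⌋

ends : ∀ {n} → List (List (Fin n)) → Fin n → ℕ
ends D v = length (filter (λ p → isEnd v p Data.Bool.≟ true) D)
  where import Data.Bool

-- D is an A-transformation of D' towards u, where H is the graph decomposed by D'
-- and A = star u X.
IsTransformationTowards : ∀ {n} → EdgeRel n → Fin n → Subset n →
  List (List (Fin n)) → List (List (Fin n)) → Set
IsTransformationTowards {n} H u X D' D =
  IsPathDecomposition (addStar H u X) D ×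
  length D ≡ length D' ×
  ends D u ≡ ends D' u + ∣ X ∣ ×
  (∀ x → x ∈ X → ends D x + 1 ≡ ends D' x) ×
  (∀ v → (v ≡ u → Data.Empty.⊥) → (v ∈ X → Data.Empty.⊥) → ends D v ≡ ends D' v)
  where import Data.Empty

IsTransformationOutwards : ∀ {n} → EdgeRel n → Fin n → Subset n →
  List (List (Fin n)) → List (List (Fin n)) → Set
IsTransformationOutwards {n} H u X D' D =
  IsPathDecomposition (addStar H u X) D ×
  length D ≡ length D' ×
  ends D u + ∣ X ∣ ≡ ends D' u ×
  (∀ x → x ∈ X → ends D x ≡ ends D' x + 1) ×
  (∀ v → (v ≡ u → Data.Empty.⊥) → (v ∈ X → Data.Empty.⊥) → ends D v ≡ ends D' v)
  where import Data.Empty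

AddibleTowards : ∀ {n} → EdgeRel n → Fin n → Subset n → List (List (Fin n)) → Set
AddibleTowards H u X D' = Σ _ (λ D → IsTransformationTowards H u X D' D)

AddibleOutwards : ∀ {n} → EdgeRel n → Fin n → Subset n → List (List (Fin n)) → Set
AddibleOutwards H u X D' = Σ _ (λ D → IsTransformationOutwards H u X D' D)

module Submission where

-- Let H = G ∖ B.  Every path of a decomposition D₀ of H passes
-- through u some number of times; each interior visit uses two edges at u and
-- each end visit one, so  deg_H(u) + D₀(u)  is even (a handshake identity at a
-- single vertex).  Since  deg_G(u) = deg_H(u) + |B|  is odd, D₀(u) + |B| is
-- odd.  If D₀(u) = 0 then |B| is odd and |B| < 2⌈|B|/2⌉; otherwise
-- |B| ≤ 2⌈|B|/2⌉ < D₀(u) + 2⌈|B|/2⌉.  Either way |B| < D₀(u) + 2|A₁|.  The two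
-- transformations give  D₂(u) = D₀(u) + |A₁| - |A₂|, and A₁, A₂ are disjoint
-- subsets of B, which turns the bound into  D₂(u) > |B| - |A₁ ∪ A₂|.

open import Defs hiding (sym)
open import Data.Nat using (ℕ; zero; suc; _+_; _*_; _≤_; _<_; _>_; _≥_; _∸_; _%_; ⌈_/2⌉; z≤n; s≤s)
open import Data.Nat.Properties
  using (+-assoc; +-comm; +-suc; +-identityʳ; ≤-trans; <-≤-trans; m≤n+m; +-mono-≤; +-monoˡ-≤; +-monoʳ-≤;
         ⌊n/2⌋≤⌈n/2⌉; ⌊n/2⌋+⌈n/2⌉≡n; m+n∸n≡m; ∸-monoˡ-<;
         +-0-commutativeMonoid; +-commutativeSemigroup)
open import Data.Nat.DivMod using ([m+n]%n≡m%n; [m+kn]%n≡m%n)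
open import Data.Nat.ListAction using (sum)
open import Data.Nat.Solver using (module +-*-Solver)
open import Data.Bool using (Bool; true; false; _∧_; _∨_; not)
import Data.Bool as Bool
open import Data.Bool.Properties using (∧-zeroʳ; ∧-identityʳ; ∨-identityʳ; ∨-comm)
open import Data.Fin using (Fin; zero; suc; _≟_)
open import Data.Fin.Subset using (Subset; _∈_; _∉_; _⊆_; _∪_; _─_; ∣_∣; inside; outside)
open import Data.Fin.Subset.Properties using (p⊆q⇒∣p∣≤∣q∣; x∈p∪q⁻; p─q⊆p)
open import Data.Vec using (_∷_; []; lookup; here; there)
open import Data.Vec.Properties using (lookup⇒[]=)
open import Data.List using (List; []; _∷_; length; filter; map; tabulate; allFin)
open import Data.List.Relation.Unary.All using (All; []; _∷_)
import Data.List.Relation.Unary.All as All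
open import Data.List.Relation.Unary.AllPairs using (_∷_)
import Data.List.Relation.Unary.Any as Any
open import Data.List.Relation.Unary.Unique.Propositional using (Unique)
open import Data.List.Membership.Propositional using () renaming (_∈_ to _∈ₗ_)
open import Data.Product using (_×_; _,_; proj₁; proj₂)
open import Data.Sum using (inj₁; inj₂)
open import Data.Empty using (⊥-elim)
open import Relation.Nullary using (yes; no; ¬_)
open import Relation.Nullary.Decidable using (⌊_⌋; dec-true; isYes≗does)
open import Relation.Binary.PropositionalEquality using (_≡_; refl; sym; trans; cong; cong₂; subst; module ≡-Reasoning)
open import Algebra.Properties.CommutativeMonoid.Sum +-0-commutativeMonoid
  using (sum-syntax; ∑-distrib-+; sum-cong-≗; sum-replicate-zero)
open import Algebra.Properties.CommutativeSemigroup +-commutativeSemigroup using (interchange)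

open +-*-Solver using (solve; _:+_; _:*_; _:=_; con)

𝟙 : Bool → ℕ
𝟙 true  = 1
𝟙 false = 0

Σₗ : ∀ {a} {A : Set a} → (A → ℕ) → List A → ℕ
Σₗ g xs = sum (map g xs)

module _ {a} {A : Set a} where

  length-filter : (f : A → Bool) (xs : List A) →
    length (filter (λ x → f x Bool.≟ true) xs) ≡ Σₗ (λ x → 𝟙 (f x)) xs
  length-filter f []       = refl
  length-filter f (x ∷ xs) with f x
  ... | true  = cong suc (length-filter f xs)
  ... | false = length-filter f xs

  Σₗ-+ : (g h : A → ℕ) (xs : List A) → Σₗ (λ x → g x + h x) xs ≡ Σₗ g xs + Σₗ h xs
  Σₗ-+ g h []       = refl
  Σₗ-+ g h (x ∷ xs) = trans (cong (g x + h x +_) (Σₗ-+ g h xs)) (interchange (g x) (h x) _ _)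

  Σₗ-congᴬ : {g h : A → ℕ} {xs : List A} → All (λ x → g x ≡ h x) xs → Σₗ g xs ≡ Σₗ h xs
  Σₗ-congᴬ []       = refl
  Σₗ-congᴬ (e ∷ es) = cong₂ _+_ e (Σₗ-congᴬ es)

  Σₗ-zero : {g : A → ℕ} {xs : List A} → All (λ x → g x ≡ 0) xs → Σₗ g xs ≡ 0
  Σₗ-zero []       = refl
  Σₗ-zero (e ∷ es) = cong₂ _+_ e (Σₗ-zero es)

  Σₗ-tabulate : ∀ {n} (g : A → ℕ) (f : Fin n → A) → Σₗ g (tabulate f) ≡ ∑[ i < n ] g (f i)
  Σₗ-tabulate {zero}  g f = refl
  Σₗ-tabulate {suc n} g f = cong (g (f zero) +_) (Σₗ-tabulate g (λ i → f (suc i)))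

  ∑-Σₗ-comm : ∀ {n} (g : Fin n → A → ℕ) (xs : List A) →
    ∑[ j < n ] Σₗ (g j) xs ≡ Σₗ (λ x → ∑[ j < n ] g j x) xs
  ∑-Σₗ-comm {n} g []       = sum-replicate-zero n
  ∑-Σₗ-comm {n} g (x ∷ xs) =
    trans (∑-distrib-+ (λ j → g j x) (λ j → Σₗ (g j) xs))
          (cong (∑[ j < n ] g j x +_) (∑-Σₗ-comm g xs))

∑-δ : ∀ {n} (y : Fin n) → ∑[ j < n ] 𝟙 ⌊ y ≟ j ⌋ ≡ 1
∑-δ {suc n} zero    = cong suc (sum-replicate-zero n)
∑-δ {suc n} (suc y) = trans (sum-cong-≗ shift) (∑-δ y)
  where
  shift : ∀ j → 𝟙 ⌊ suc y ≟ suc j ⌋ ≡ 𝟙 ⌊ y ≟ j ⌋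
  shift j with y ≟ j
  ... | yes _ = refl
  ... | no  _ = refl

∣∣≡∑ : ∀ {n} (X : Subset n) → ∣ X ∣ ≡ ∑[ j < n ] 𝟙 (lookup X j)
∣∣≡∑ []            = refl
∣∣≡∑ (inside  ∷ X) = cong suc (∣∣≡∑ X)
∣∣≡∑ (outside ∷ X) = ∣∣≡∑ X

Undirected : ∀ {n} → EdgeRel n → Set
Undirected H = ∀ a b → H a b ≡ H b a

degreeIn : ∀ {n} → EdgeRel n → Fin n → ℕ
degreeIn {n} H u = ∑[ j < n ] 𝟙 (H u j)

deg≡degreeIn : ∀ {n} (G : SimpleGraph n) u → deg G u ≡ degreeIn (adj G) u
deg≡degreeIn {n} G u = trans (length-filter (adj G u) (allFin n)) (Σₗ-tabulate (λ j → 𝟙 (adj G u j)) (λ i → i))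

removeStar-undirected : ∀ {n} {H : EdgeRel n} u X → Undirected H → Undirected (removeStar H u X)
removeStar-undirected {H = H} u X hs a b =
  cong₂ (λ e s → e ∧ not s) (hs a b) (∨-comm (⌊ a ≟ u ⌋ ∧ lookup X b) (⌊ b ≟ u ⌋ ∧ lookup X a))

star-centre : ∀ {n} (u : Fin n) X j → lookup X u ≡ false → star u X u j ≡ lookup X j
star-centre u X j u∉X = begin
  (⌊ u ≟ u ⌋ ∧ lookup X j) ∨ (⌊ j ≟ u ⌋ ∧ lookup X u)
    ≡⟨ cong₂ (λ s t → (s ∧ lookup X j) ∨ (⌊ j ≟ u ⌋ ∧ t)) (trans (isYes≗does (u ≟ u)) (dec-true (u ≟ u) refl)) u∉X ⟩
  lookup X j ∨ (⌊ j ≟ u ⌋ ∧ false) ≡⟨ cong (lookup X j ∨_) (∧-zeroʳ _) ⟩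
  lookup X j ∨ false               ≡⟨ ∨-identityʳ _ ⟩
  lookup X j                       ∎
  where open ≡-Reasoning

degree-removeStar : ∀ {n} (H : EdgeRel n) u X → H u u ≡ false → (∀ x → x ∈ X → H u x ≡ true) →
  degreeIn H u ≡ degreeIn (removeStar H u X) u + ∣ X ∣
degree-removeStar {n} H u X loopless X⊆N = begin
  ∑[ j < n ] 𝟙 (H u j)                                     ≡⟨ sum-cong-≗ split ⟩
  ∑[ j < n ] (𝟙 (removeStar H u X u j) + 𝟙 (lookup X j))  ≡⟨ ∑-distrib-+ (λ j → 𝟙 (removeStar H u X u j)) (λ j → 𝟙 (lookup X j)) ⟩
  degreeIn (removeStar H u X) u + ∑[ j < n ] 𝟙 (lookup X j) ≡⟨ cong (degreeIn (removeStar H u X) u +_) (sym (∣∣≡∑ X)) ⟩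
  degreeIn (removeStar H u X) u + ∣ X ∣                     ∎
  where
  open ≡-Reasoning
  u∉X : lookup X u ≡ false
  u∉X with lookup X u in e
  ... | false = refl
  ... | true  with trans (sym loopless) (X⊆N u (lookup⇒[]= u X e))
  ... | ()
  split : ∀ j → 𝟙 (H u j) ≡ 𝟙 (removeStar H u X u j) + 𝟙 (lookup X j)
  split j rewrite star-centre u X j u∉X with lookup X j in e
  ... | true  rewrite X⊆N j (lookup⇒[]= j X e) = refl
  ... | false rewrite ∧-identityʳ (H u j) = sym (+-identityʳ _)

-- The test used by Defs.occ: does the ordered pair of vertices run along the edge ij?
sameEdge : ∀ {n} → Fin n → Fin n → Fin n × Fin n → Bool
sameEdge i j (a , b) = (⌊ a ≟ i ⌋ ∧ ⌊ b ≟ j ⌋) ∨ (⌊ a ≟ j ⌋ ∧ ⌊ b ≟ i ⌋)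

occ≡Σ : ∀ {n} (i j : Fin n) p → occ i j p ≡ Σₗ (λ e → 𝟙 (sameEdge i j e)) (pairs p)
occ≡Σ i j p = length-filter (sameEdge i j) (pairs p)

incidences : ∀ {n} → Fin n → List (Fin n) → ℕ
incidences {n} u p = ∑[ j < n ] occ u j p

visits : ∀ {n} → Fin n → List (Fin n) → ℕ
visits u p = Σₗ (λ v → 𝟙 ⌊ v ≟ u ⌋) p

step-incidences : ∀ {n} (u x y : Fin n) → ¬ x ≡ y →
  ∑[ j < n ] 𝟙 (sameEdge u j (x , y)) ≡ 𝟙 ⌊ x ≟ u ⌋ + 𝟙 ⌊ y ≟ u ⌋
step-incidences {n} u x y x≢y with x ≟ u | y ≟ u
... | yes x≡u | yes y≡u = ⊥-elim (x≢y (trans x≡u (sym y≡u)))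
... | yes _   | no _    =
  trans (sum-cong-≗ (λ j → cong 𝟙 (trans (cong (⌊ y ≟ j ⌋ ∨_) (∧-zeroʳ ⌊ x ≟ j ⌋)) (∨-identityʳ ⌊ y ≟ j ⌋)))) (∑-δ y)
... | no _    | yes _   = trans (sum-cong-≗ (λ j → cong 𝟙 (∧-identityʳ ⌊ x ≟ j ⌋))) (∑-δ x)
... | no _    | no _    = trans (sum-cong-≗ (λ j → cong 𝟙 (∧-zeroʳ ⌊ x ≟ j ⌋))) (sum-replicate-zero n)

incidences-cons : ∀ {n} (u x y : Fin n) ys → ¬ x ≡ y →
  incidences u (x ∷ y ∷ ys) ≡ 𝟙 ⌊ x ≟ u ⌋ + 𝟙 ⌊ y ≟ u ⌋ + incidences u (y ∷ ys)
incidences-cons {n} u x y ys x≢y = begin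
  ∑[ j < n ] occ u j (x ∷ y ∷ ys)
    ≡⟨ sum-cong-≗ occ-cons ⟩
  ∑[ j < n ] (𝟙 (sameEdge u j (x , y)) + occ u j (y ∷ ys))
    ≡⟨ ∑-distrib-+ (λ j → 𝟙 (sameEdge u j (x , y))) (λ j → occ u j (y ∷ ys)) ⟩
  ∑[ j < n ] 𝟙 (sameEdge u j (x , y)) + incidences u (y ∷ ys)
    ≡⟨ cong (_+ incidences u (y ∷ ys)) (step-incidences u x y x≢y) ⟩
  𝟙 ⌊ x ≟ u ⌋ + 𝟙 ⌊ y ≟ u ⌋ + incidences u (y ∷ ys) ∎
  where
  open ≡-Reasoning
  occ-cons : ∀ j → occ u j (x ∷ y ∷ ys) ≡ 𝟙 (sameEdge u j (x , y)) + occ u j (y ∷ ys)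
  occ-cons j = trans (occ≡Σ u j (x ∷ y ∷ ys)) (cong (_ +_) (sym (occ≡Σ u j (y ∷ ys))))

walk-handshake : ∀ {n} (u x : Fin n) xs → Unique (x ∷ xs) →
  incidences u (x ∷ xs) + 𝟙 ⌊ x ≟ u ⌋ + 𝟙 ⌊ lastOf x xs ≟ u ⌋ ≡ visits u (x ∷ xs) + visits u (x ∷ xs)
walk-handshake {n} u x [] _ rewrite sum-replicate-zero n | +-identityʳ (𝟙 ⌊ x ≟ u ⌋) = refl
walk-handshake {n} u x (y ∷ ys) ((x≢y ∷ _) ∷ distinct) = begin
  incidences u (x ∷ y ∷ ys) + ix + il ≡⟨ cong (λ t → t + ix + il) (incidences-cons u x y ys x≢y) ⟩
  ix + iy + I + ix + il               ≡⟨ solve 4 (λ ix iy I il → ix :+ iy :+ I :+ ix :+ il := ix :+ ix :+ (I :+ iy :+ il)) refl ix iy I il ⟩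
  ix + ix + (I + iy + il)             ≡⟨ cong (ix + ix +_) (walk-handshake u y ys distinct) ⟩
  ix + ix + (V + V)                   ≡⟨ solve 2 (λ ix V → ix :+ ix :+ (V :+ V) := (ix :+ V) :+ (ix :+ V)) refl ix V ⟩
  (ix + V) + (ix + V)                 ∎
  where
  open ≡-Reasoning
  ix = 𝟙 ⌊ x ≟ u ⌋
  iy = 𝟙 ⌊ y ≟ u ⌋
  il = 𝟙 ⌊ lastOf y ys ≟ u ⌋
  I  = incidences u (y ∷ ys)
  V  = visits u (y ∷ ys)

last∈ : ∀ {n} (y : Fin n) ys → lastOf y ys ∈ₗ (y ∷ ys)
last∈ y []       = Any.here refl
last∈ y (z ∷ zs) = Any.there (last∈ z zs)

-- The two ends of a path with distinct vertices are different, so u is an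
-- end of it exactly as often as it is its first or its last vertex.
isEnd-split : ∀ {n} (u x y : Fin n) ys → Unique (x ∷ y ∷ ys) →
  𝟙 (isEnd u (x ∷ y ∷ ys)) ≡ 𝟙 ⌊ x ≟ u ⌋ + 𝟙 ⌊ lastOf y ys ≟ u ⌋
isEnd-split u x y ys (x∉rest ∷ _) with x ≟ u | lastOf y ys ≟ u
... | yes x≡u | yes l≡u = ⊥-elim (All.lookup x∉rest (last∈ y ys) (trans x≡u (sym l≡u)))
... | yes _   | no _    = refl
... | no _    | yes _   = refl
... | no _    | no _    = refl

path-handshake : ∀ {n} {H : EdgeRel n} u p → IsPath H p →
  incidences u p + 𝟙 (isEnd u p) ≡ visits u p + visits u p
path-handshake u (x ∷ y ∷ ys) (_ , distinct , _) = begin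
  incidences u (x ∷ y ∷ ys) + 𝟙 (isEnd u (x ∷ y ∷ ys))
    ≡⟨ cong (incidences u (x ∷ y ∷ ys) +_) (isEnd-split u x y ys distinct) ⟩
  incidences u (x ∷ y ∷ ys) + (𝟙 ⌊ x ≟ u ⌋ + 𝟙 ⌊ lastOf y ys ≟ u ⌋)
    ≡⟨ sym (+-assoc (incidences u (x ∷ y ∷ ys)) _ _) ⟩
  incidences u (x ∷ y ∷ ys) + 𝟙 ⌊ x ≟ u ⌋ + 𝟙 ⌊ lastOf y ys ≟ u ⌋
    ≡⟨ walk-handshake u x (y ∷ ys) distinct ⟩
  visits u (x ∷ y ∷ ys) + visits u (x ∷ y ∷ ys) ∎
  where open ≡-Reasoning
path-handshake u []      (() , _)
path-handshake u (_ ∷ []) (s≤s () , _)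

sameEdge⇒edge : ∀ {n} {H : EdgeRel n} → Undirected H → ∀ u j a b →
  sameEdge u j (a , b) ≡ true → H a b ≡ H u j
sameEdge⇒edge hs u j a b along with a ≟ u | b ≟ j | a ≟ j | b ≟ u
sameEdge⇒edge hs u j a b along | yes refl | yes refl | _        | _        = refl
sameEdge⇒edge hs u j a b along | _        | _        | yes refl | yes refl = hs j u
sameEdge⇒edge hs u j a b ()    | no _     | _        | no _     | _
sameEdge⇒edge hs u j a b ()    | no _     | _        | yes _    | no _
sameEdge⇒edge hs u j a b ()    | yes _    | no _     | no _     | _
sameEdge⇒edge hs u j a b ()    | yes _    | no _     | yes _    | no _

occ-nonedge : ∀ {n} {H : EdgeRel n} → Undirected H → ∀ u j → H u j ≡ false →
  ∀ p → IsPath H p → occ u j p ≡ 0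
occ-nonedge {H = H} hs u j nonedge p (_ , _ , steps) =
  trans (occ≡Σ u j p) (Σₗ-zero (All.map notAlong steps))
  where
  notAlong : ∀ {e} → H (proj₁ e) (proj₂ e) ≡ true → 𝟙 (sameEdge u j e) ≡ 0
  notAlong {a , b} edge with sameEdge u j (a , b) in along
  ... | false = refl
  ... | true  with trans (sym nonedge) (trans (sym (sameEdge⇒edge hs u j a b along)) edge)
  ... | ()

traversals : ∀ {n} {H : EdgeRel n} {D} → Undirected H → IsPathDecomposition H D →
  ∀ u j → Σₗ (occ u j) D ≡ 𝟙 (H u j)
traversals {H = H} hs (paths , covers) u j with H u j in edge
... | true  = covers u j edge
... | false = Σₗ-zero (All.map (λ {p} → occ-nonedge hs u j edge p) paths)

degree+ends≡2visits : ∀ {n} {H : EdgeRel n} {D} → Undirected H → IsPathDecomposition H D →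
  ∀ u → degreeIn H u + ends D u ≡ Σₗ (visits u) D + Σₗ (visits u) D
degree+ends≡2visits {n} {H} {D} hs decomposition u = begin
  degreeIn H u + ends D u
    ≡⟨ cong₂ _+_ (sum-cong-≗ (λ j → sym (traversals hs decomposition u j))) (length-filter (isEnd u) D) ⟩
  ∑[ j < n ] Σₗ (occ u j) D + Σₗ (λ p → 𝟙 (isEnd u p)) D
    ≡⟨ cong (_+ Σₗ (λ p → 𝟙 (isEnd u p)) D) (∑-Σₗ-comm (λ j p → occ u j p) D) ⟩
  Σₗ (incidences u) D + Σₗ (λ p → 𝟙 (isEnd u p)) D
    ≡⟨ sym (Σₗ-+ (incidences u) (λ p → 𝟙 (isEnd u p)) D) ⟩
  Σₗ (λ p → incidences u p + 𝟙 (isEnd u p)) D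
    ≡⟨ Σₗ-congᴬ (All.map (λ {p} → path-handshake u p) (proj₁ decomposition)) ⟩
  Σₗ (λ p → visits u p + visits u p) D
    ≡⟨ Σₗ-+ (visits u) (visits u) D ⟩
  Σₗ (visits u) D + Σₗ (visits u) D ∎
  where open ≡-Reasoning

odd⇒<2⌈/2⌉ : ∀ b → b % 2 ≡ 1 → b < ⌈ b /2⌉ + ⌈ b /2⌉
odd⇒<2⌈/2⌉ zero          ()
odd⇒<2⌈/2⌉ (suc zero)    _   = s≤s (s≤s z≤n)
odd⇒<2⌈/2⌉ (suc (suc b)) odd =
  s≤s (subst (suc (suc b) ≤_) (sym (+-suc ⌈ b /2⌉ ⌈ b /2⌉)) (s≤s (odd⇒<2⌈/2⌉ b b-odd)))
  where
  b-odd : b % 2 ≡ 1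
  b-odd = trans (sym ([m+n]%n≡m%n b 2)) (trans (cong (_% 2) (+-comm b 2)) odd)

-- If e + b is odd then b < e + 2⌈b/2⌉: either e = 0 and b is odd, or e ≥ 1
-- and b ≤ 2⌈b/2⌉ already suffices.
odd-bound : ∀ e b → (e + b) % 2 ≡ 1 → b < e + (⌈ b /2⌉ + ⌈ b /2⌉)
odd-bound zero    b odd = odd⇒<2⌈/2⌉ b odd
odd-bound (suc e) b _   = s≤s (≤-trans b≤2⌈b/2⌉ (m≤n+m _ e))
  where
  b≤2⌈b/2⌉ : b ≤ ⌈ b /2⌉ + ⌈ b /2⌉
  b≤2⌈b/2⌉ = subst (_≤ ⌈ b /2⌉ + ⌈ b /2⌉) (⌊n/2⌋+⌈n/2⌉≡n b) (+-monoˡ-≤ ⌈ b /2⌉ (⌊n/2⌋≤⌈n/2⌉ b))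

odd-transfer : ∀ d e b K → (d + b) % 2 ≡ 1 → d + e ≡ K + K → (e + b) % 2 ≡ 1
odd-transfer d e b K odd even = begin
  (e + b) % 2           ≡⟨ sym ([m+kn]%n≡m%n (e + b) K 2) ⟩
  (e + b + K * 2) % 2   ≡⟨ cong (_% 2) shuffle ⟩
  (d + b + e * 2) % 2   ≡⟨ [m+kn]%n≡m%n (d + b) e 2 ⟩
  (d + b) % 2           ≡⟨ odd ⟩
  1                     ∎
  where
  open ≡-Reasoning
  shuffle : e + b + K * 2 ≡ d + b + e * 2
  shuffle = begin
    e + b + K * 2   ≡⟨ solve 3 (λ e b K → e :+ b :+ K :* con 2 := e :+ b :+ (K :+ K)) refl e b K ⟩
    e + b + (K + K) ≡⟨ cong (e + b +_) (sym even) ⟩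
    e + b + (d + e) ≡⟨ solve 3 (λ d e b → e :+ b :+ (d :+ e) := d :+ b :+ e :* con 2) refl d e b ⟩
    d + b + e * 2   ∎

x∈p─q⇒x∉q : ∀ {n} (p q : Subset n) {x} → x ∈ p ─ q → x ∉ q
x∈p─q⇒x∉q (inside  ∷ p) (outside ∷ q) here       ()
x∈p─q⇒x∉q (_       ∷ p) (_       ∷ q) (there x∈) (there x∈q) = x∈p─q⇒x∉q p q x∈ x∈q

∣p∪q∣≡∣p∣+∣q∣ : ∀ {n} (p q : Subset n) → (∀ {x} → x ∈ p → x ∉ q) → ∣ p ∪ q ∣ ≡ ∣ p ∣ + ∣ q ∣
∣p∪q∣≡∣p∣+∣q∣ []            []            _        = refl
∣p∪q∣≡∣p∣+∣q∣ (inside  ∷ p) (inside  ∷ q) disjoint = ⊥-elim (disjoint here here)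
∣p∪q∣≡∣p∣+∣q∣ (inside  ∷ p) (outside ∷ q) disjoint =
  cong suc (∣p∪q∣≡∣p∣+∣q∣ p q (λ x∈p x∈q → disjoint (there x∈p) (there x∈q)))
∣p∪q∣≡∣p∣+∣q∣ (outside ∷ p) (inside  ∷ q) disjoint =
  trans (cong suc (∣p∪q∣≡∣p∣+∣q∣ p q (λ x∈p x∈q → disjoint (there x∈p) (there x∈q)))) (sym (+-suc ∣ p ∣ ∣ q ∣))
∣p∪q∣≡∣p∣+∣q∣ (outside ∷ p) (outside ∷ q) disjoint =
  ∣p∪q∣≡∣p∣+∣q∣ p q (λ x∈p x∈q → disjoint (there x∈p) (there x∈q))

-- The bookkeeping of the two transformations: D₁(u) = D₀(u) + a₁ and
-- D₂(u) = D₁(u) - a₂ turn  b < D₀(u) + 2a₁  into  b - (a₁ + a₂) < D₂(u).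
transformed-bound : ∀ b e₀ e₁ e₂ a₁ a₂ → b < e₀ + (a₁ + a₁) →
  e₁ ≡ e₀ + a₁ → e₂ + a₂ ≡ e₁ → a₁ + a₂ ≤ b → b ∸ (a₁ + a₂) < e₂
transformed-bound b e₀ e₁ e₂ a₁ a₂ bound towards outwards a₁+a₂≤b =
  subst (b ∸ (a₁ + a₂) <_) (m+n∸n≡m e₂ (a₁ + a₂))
    (∸-monoˡ-< (subst (b <_) rebalance bound) a₁+a₂≤b)
  where
  open ≡-Reasoning
  rebalance : e₀ + (a₁ + a₁) ≡ e₂ + (a₁ + a₂)
  rebalance = begin
    e₀ + (a₁ + a₁) ≡⟨ sym (+-assoc e₀ a₁ a₁) ⟩
    e₀ + a₁ + a₁   ≡⟨ cong (_+ a₁) (trans (sym towards) (sym outwards)) ⟩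
    e₂ + a₂ + a₁   ≡⟨ trans (+-assoc e₂ a₂ a₁) (cong (e₂ +_) (+-comm a₂ a₁)) ⟩
    e₂ + (a₁ + a₂) ∎

lemma2p6 : ∀ {n} (G : SimpleGraph n) (u : Fin n) (B A₁ A₂ : Subset n)
    (D₀ D₁ D₂ : List (List (Fin n))) →
    deg G u % 2 ≡ 1 →
    StarIn G u B →
    IsPathDecomposition (removeStar (adj G) u B) D₀ →
    A₁ ⊆ B →
    AddibleTowards (removeStar (adj G) u B) u A₁ D₀ →
    IsTransformationTowards (removeStar (adj G) u B) u A₁ D₀ D₁ →
    A₂ ⊆ (B ─ A₁) →
    AddibleOutwards (addStar (removeStar (adj G) u B) u A₁) u A₂ D₁ →
    IsTransformationOutwards (addStar (removeStar (adj G) u B) u A₁) u A₂ D₁ D₂ →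
    ∣ A₁ ∣ ≥ ⌈ ∣ B ∣ /2⌉ →
    ends D₂ u > ∣ B ∣ ∸ ∣ A₁ ∪ A₂ ∣
lemma2p6 G u B A₁ A₂ D₀ D₁ D₂ deg-odd B⊆N decomposition A₁⊆B _ towards A₂⊆B─A₁ _ outwards half =
  subst (λ s → ∣ B ∣ ∸ s < ends D₂ u) (sym ∣A₁∪A₂∣)
    (transformed-bound (∣ B ∣) (ends D₀ u) (ends D₁ u) (ends D₂ u) (∣ A₁ ∣) (∣ A₂ ∣)
       bound (proj₁ (proj₂ (proj₂ towards))) (proj₁ (proj₂ (proj₂ outwards)))
       (subst (_≤ ∣ B ∣) ∣A₁∪A₂∣ (p⊆q⇒∣p∣≤∣q∣ A₁∪A₂⊆B)))
  where
  H = removeStar (adj G) u B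
  -- deg_G(u) = deg_H(u) + |B| is odd, while deg_H(u) + D₀(u) is even.
  H-odd : (degreeIn H u + ∣ B ∣) % 2 ≡ 1
  H-odd = subst (λ d → d % 2 ≡ 1)
    (trans (deg≡degreeIn G u) (degree-removeStar (adj G) u B (irrefl G u) B⊆N)) deg-odd
  ends-odd : (ends D₀ u + ∣ B ∣) % 2 ≡ 1
  ends-odd = odd-transfer (degreeIn H u) (ends D₀ u) (∣ B ∣) (Σₗ (visits u) D₀) H-odd
    (degree+ends≡2visits (removeStar-undirected u B (SimpleGraph.sym G)) decomposition u)
  bound : ∣ B ∣ < ends D₀ u + (∣ A₁ ∣ + ∣ A₁ ∣)
  bound = <-≤-trans (odd-bound (ends D₀ u) (∣ B ∣) ends-odd) (+-monoʳ-≤ (ends D₀ u) (+-mono-≤ half half))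
  ∣A₁∪A₂∣ : ∣ A₁ ∪ A₂ ∣ ≡ ∣ A₁ ∣ + ∣ A₂ ∣
  ∣A₁∪A₂∣ = ∣p∪q∣≡∣p∣+∣q∣ A₁ A₂ (λ x∈A₁ x∈A₂ → x∈p─q⇒x∉q B A₁ (A₂⊆B─A₁ x∈A₂) x∈A₁)
  A₁∪A₂⊆B : A₁ ∪ A₂ ⊆ B
  A₁∪A₂⊆B x∈ with x∈p∪q⁻ A₁ A₂ x∈
  ... | inj₁ x∈A₁ = A₁⊆B x∈A₁
  ... | inj₂ x∈A₂ = p─q⊆p B A₁ (A₂⊆B─A₁ x∈A₂)
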